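{- Let $G$ be a graph with no infinite independent set. Then every chain of the tree $T(G)$ of robust modules of $G$ is finite.
   Context: Graphs are undirected without loops. A module of a graph $G=(V,E)$ is a set $A\subseteq V$ such that every vertex $x\notin A$ is either adjacent to all vertices of $A$ or to none. A strong module is a nonempty module $A$ such that every module of $G$ is either disjoint from $A$ or comparable with $A$ under inclusion. Intersections of strong modules are empty or strong, so for nonempty $F\subseteq V$ the set $S(F)$, the intersection of all strong modules containing $F$, is the least strong module containing $F$. A robust module is a set of the form $S(\{x,y\})$ for (possibly equal) vertices $x,y$. $T(G)$ is the set of robust modules of $G$ ordered by reverse inclusion (it is a tree). -}

module Defs where

open import Level using (Level; _⊔_) renaming (suc to lsuc)
open import Data.Nat using (ℕ)
open import Data.Fin using (Fin)
open import Data.Product using (Σ; _×_; _,_; proj₁; proj₂)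
open import Data.Sum using (_⊎_)
open import Data.Empty using (⊥)
open import Relation.Nullary using (¬_)
open import Relation.Binary.PropositionalEquality using (_≡_)

record Graph : Set₁ where
  field
    V     : Set
    Adj   : V → V → Set
    sym   : ∀ {x y} → Adj x y → Adj y x
    irrefl : ∀ {x} → ¬ Adj x x

_⊆_ : ∀ {a ℓ₁ ℓ₂} {A : Set a} → (A → Set ℓ₁) → (A → Set ℓ₂) → Set (a ⊔ ℓ₁ ⊔ ℓ₂)
P ⊆ Q = ∀ x → P x → Q x

_≐_ : ∀ {a ℓ₁ ℓ₂} {A : Set a} → (A → Set ℓ₁) → (A → Set ℓ₂) → Set (a ⊔ ℓ₁ ⊔ ℓ₂)
P ≐ Q = (P ⊆ Q) × (Q ⊆ P)

Disjoint : ∀ {a ℓ₁ ℓ₂} {A : Set a} → (A → Set ℓ₁) → (A → Set ℓ₂) → Set (a ⊔ ℓ₁ ⊔ ℓ₂)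
Disjoint P Q = ∀ x → P x → Q x → ⊥

Finite : ∀ {a ℓ} {A : Set a} → (A → Set ℓ) → Set (a ⊔ ℓ)
Finite {A = A} P = Σ ℕ λ n → Σ (Fin n → A) λ f → ∀ x → P x → Σ (Fin n) λ k → f k ≡ x

module _ (G : Graph) where
  open Graph G

  IsModule : (V → Set) → Set
  IsModule A = ∀ x → ¬ A x → (∀ a → A a → Adj x a) ⊎ (∀ a → A a → ¬ Adj x a)

  IsStrongModule : (V → Set) → Set₁
  IsStrongModule A =
    Σ V A ×
    (∀ (B : V → Set) → IsModule B → Disjoint A B ⊎ (A ⊆ B ⊎ B ⊆ A))

  S₂ : V → V → V → Set₁
  S₂ x y z = ∀ (A : V → Set) → IsStrongModule A → A x → A y → A z

  Independent : (V → Set) → Set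
  Independent A = ∀ x y → A x → A y → ¬ Adj x y

  NoInfiniteIndependentSet : Set₁
  NoInfiniteIndependentSet = ∀ (A : V → Set) → ¬ (Independent A × ¬ Finite A)

  -- A family of robust modules S({x_i,y_i}), i ∈ I (given by representative
  -- pairs), that is a chain of T(G): pairwise comparable under inclusion.
  -- The set of robust modules it describes is its image { S(c i) | i ∈ I };
  -- every chain of T(G) arises this way (take I = pairs whose S lies in the chain).
  RobustOf : (V × V) → V → Set₁
  RobustOf p = S₂ (proj₁ p) (proj₂ p)

  IsChainFamily : {I : Set} → (I → V × V) → Set₁
  IsChainFamily {I} c = ∀ i j → (RobustOf (c i) ⊆ RobustOf (c j)) ⊎ (RobustOf (c j) ⊆ RobustOf (c i))

  FiniteImage : {I : Set} → (I → V × V) → Set₁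
  FiniteImage {I} c = Σ ℕ λ n → Σ (Fin n → I) λ g →
    ∀ i → Σ (Fin n) λ k → RobustOf (c (g k)) ≐ RobustOf (c i)

{-# OPTIONS --safe #-}
-- Let H i be the module closure of the robust module T i = S({x_i, y_i}). Along a chain, distinct
-- robust modules have distinct closures, so an infinite chain of robust modules gives an infinite
-- chain of modules H i. Whenever H p ⊊ H q ⊊ H r, some vertex of H r ∖ H p is anticomplete to H p,
-- and hence to every H j that misses it. Finitely many such vertices cut the chain into finitely
-- many intervals, one of which still carries infinitely many H i; a vertex found in a gap inside
-- that interval is distinct from and non-adjacent to all of them. Iterating yields an infinite
-- independent set.
module Submission where

open import Defs
open import Level using (Level)
open import Data.Product using (_×_)
open import Axiom.ExcludedMiddle using (ExcludedMiddle)

open import Level using (Lift; lift; 0ℓ; _⊔_) renaming (suc to lsuc)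
open import Axiom.DoubleNegationElimination using (em⇒dne)
open import Data.Empty using (⊥-elim)
open import Data.Fin as Fin using (Fin; toℕ; _↑ˡ_; _↑ʳ_)
open import Data.Fin.Properties using (pigeonhole)
open import Data.List using (List; []; _∷_)
open import Data.List.Membership.Propositional using (_∈_)
open import Data.List.Relation.Unary.All as All using (All; []; _∷_)
open import Data.List.Relation.Unary.Any using (here; there)
open import Data.Nat using (ℕ; zero; suc; _<_; _+_)
open import Data.Nat.Properties using (<-cmp; n<1+n; m<1+n⇒m<n∨m≡n)
open import Data.Product using (Σ; ∃; _,_; proj₁; proj₂; uncurry)
open import Data.Unit using (⊤; tt)
open import Data.Vec.Functional as Vector using (_++_)
open import Data.Vec.Functional.Properties using (lookup-++ˡ; lookup-++ʳ)
open import Data.Sum as Sum using (_⊎_; inj₁; inj₂; [_,_]′)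
open import Function using (_∘_; id)
open import Function.Bundles using (_⇔_; mk⇔; Equivalence)
open import Function.Properties.Equivalence using (⇔-setoid) renaming (refl to ⇔-refl)
import Relation.Binary.Reasoning.Setoid as SetoidReasoning
open import Relation.Nullary using (¬_; yes; no)
open import Relation.Nullary.Decidable using (True; toWitness; fromWitness)
open import Relation.Unary using (Pred; Satisfiable; U; _∪_; _∩_; _∖_; _≬_; ∁; ｛_｝)
open import Relation.Binary.Definitions using (tri<; tri≈; tri>)
open import Relation.Binary.PropositionalEquality using (_≡_; _≢_; refl; sym; cong; subst; module ≡-Reasoning)

module Classical (lem : ∀ {ℓ} → ExcludedMiddle ℓ) where

  private variable
    a b ℓ : Level
    A : Set a

  dne : ¬ ¬ A → A
  dne = em⇒dne lem

  ¬∀⇒∃¬ : {B : A → Set b} → ¬ (∀ x → B x) → ∃ λ x → ¬ B x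
  ¬∀⇒∃¬ ¬∀ = dne λ ∄ → ¬∀ λ x → dne λ ¬Bx → ∄ (x , ¬Bx)

  ¬→⇒×¬ : {B : Set b} → ¬ (A → B) → A × ¬ B
  ¬→⇒×¬ ¬[A→B] = dne (λ ¬A → ¬[A→B] λ a → ⊥-elim (¬A a)) , λ b → ¬[A→B] λ _ → b

  ¬⊆⇒∖ : {P Q : Pred A ℓ} → ¬ (P ⊆ Q) → Satisfiable (P ∖ Q)
  ¬⊆⇒∖ ¬⊆ with x , ¬[P⇒Q] ← ¬∀⇒∃¬ ¬⊆ = x , ¬→⇒×¬ ¬[P⇒Q]

  -- Excluded middle makes every proposition equivalent to a small one. This is needed because S₂ and
  -- module closures are Set₁-valued, while the definitions quantify over Set-valued modules.
  Resize : Set a → Set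
  Resize A = True (lem {P = A})

  resize : A → Resize A
  resize = fromWitness

  unresize : Resize A → A
  unresize = toWitness

image-infinite : ∀ {a} {A : Set a} (s : ℕ → A) → (∀ {m n} → m < n → s m ≢ s n) →
                 ¬ Finite (λ x → ∃ λ n → s n ≡ x)
image-infinite s distinct (n , f , cover) =
  let i , j , i<j , same = pigeonhole (n<1+n n) (proj₁ ∘ index) in
  distinct i<j (begin
    s (toℕ i)            ≡⟨ proj₂ (index i) ⟨
    f (proj₁ (index i))  ≡⟨ cong f same ⟩
    f (proj₁ (index j))  ≡⟨ proj₂ (index j) ⟩
    s (toℕ j)            ∎)
  where
  open ≡-Reasoning
  index : (k : Fin (suc n)) → ∃ λ l → f l ≡ s (toℕ k)
  index k = cover (s (toℕ k)) (toℕ k , refl)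

module _ (G : Graph) where
  open Graph G renaming (sym to Adj-sym)

  Apart : V → V → Set
  Apart v w = v ≢ w × ¬ Adj v w

  infinite-independent-of-extension : ∀ {ℓ} (P : Pred V ℓ) →
                                      (∀ L → All P L → ∃ λ v → P v × All (Apart v) L) →
                                      ∃ λ (A : Pred V 0ℓ) → Independent G A × ¬ Finite A
  infinite-independent-of-extension P extend =
    image , independent , image-infinite seq (λ m<n → proj₁ (apart m<n) ∘ sym)
    where
    extend′ : (L : Σ (List V) (All P)) → ∃ λ v → P v × All (Apart v) (proj₁ L)
    extend′ (L , PL) = extend L PL

    prefix : ℕ → Σ (List V) (All P)
    prefix zero = [] , []
    prefix (suc n) = let v , Pv , _ = extend′ (prefix n) in v ∷ proj₁ (prefix n) , Pv ∷ proj₂ (prefix n)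

    seq : ℕ → V
    seq n = proj₁ (extend′ (prefix n))

    seq-∈-prefix : ∀ {m n} → m < n → seq m ∈ proj₁ (prefix n)
    seq-∈-prefix {n = suc n} m<1+n with m<1+n⇒m<n∨m≡n m<1+n
    ... | inj₁ m<n = there (seq-∈-prefix m<n)
    ... | inj₂ refl = here refl

    apart : ∀ {m n} → m < n → Apart (seq n) (seq m)
    apart {n = n} m<n = All.lookup (proj₂ (proj₂ (extend′ (prefix n)))) (seq-∈-prefix m<n)

    image : Pred V 0ℓ
    image w = ∃ λ n → seq n ≡ w

    independent : Independent G image
    independent _ _ (m , refl) (n , refl) with <-cmp m n
    ... | tri< m<n _ _ = proj₂ (apart m<n) ∘ Adj-sym
    ... | tri≈ _ refl _ = irrefl
    ... | tri> _ _ n<m = proj₂ (apart n<m)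

module ModularDecomposition (lem : ∀ {ℓ} → ExcludedMiddle ℓ) (G : Graph) where
  open Classical lem
  open Graph G renaming (sym to Adj-sym)

  private variable
    ℓ ℓ₁ ℓ₂ ℓ₃ : Level
    P : Pred V ℓ
    Q : Pred V ℓ₁
    R : Pred V ℓ₂
    N : Pred V ℓ₃
    u v w x y z a b : V

  Complete Anticomplete Uniform : V → Pred V ℓ → Set ℓ
  Complete u P = ∀ z → P z → Adj u z
  Anticomplete u P = ∀ z → P z → ¬ Adj u z
  Uniform u P = Complete u P ⊎ Anticomplete u P

  Module : Pred V ℓ → Set ℓ
  Module P = ∀ u → ¬ P u → Uniform u P

  uniform-⊆ : Q ⊆ P → Uniform u P → Uniform u Q
  uniform-⊆ Q⊆P = Sum.map (λ c z Qz → c z (Q⊆P z Qz)) (λ c z Qz → c z (Q⊆P z Qz))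

  uniform-⇔ : Uniform u P → P a → P b → Adj u a ⇔ Adj u b
  uniform-⇔ (inj₁ c) Pa Pb = mk⇔ (λ _ → c _ Pb) (λ _ → c _ Pa)
  uniform-⇔ (inj₂ c) Pa Pb = mk⇔ (λ u~a → ⊥-elim (c _ Pa u~a)) (λ u~b → ⊥-elim (c _ Pb u~b))

  uniform-of-⇔ : (C : Set) → (∀ z → P z → Adj u z ⇔ C) → Uniform u P
  uniform-of-⇔ C agree with lem {P = C}
  ... | yes c = inj₁ λ z Pz → Equivalence.from (agree z Pz) c
  ... | no ¬c = inj₂ λ z Pz u~z → ¬c (Equivalence.to (agree z Pz) u~z)

  module-⊆ : Module P → Q ⊆ P → ¬ P u → Uniform u Q
  module-⊆ mP Q⊆P ¬Pu = uniform-⊆ Q⊆P (mP _ ¬Pu)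

  Adj-⇔ : Adj x y ⇔ Adj y x
  Adj-⇔ = mk⇔ Adj-sym Adj-sym

  ∪-module : Module P → Module Q → P z → Q z → Module (P ∪ Q)
  ∪-module {z = z} mP mQ Pz Qz u ∉P∪Q = uniform-of-⇔ (Adj u z)
    λ w → [ (λ Pw → uniform-⇔ (mP u (∉P∪Q ∘ inj₁)) Pw Pz) , (λ Qw → uniform-⇔ (mQ u (∉P∪Q ∘ inj₂)) Qw Qz) ]′

  ∖-module : Module P → Module Q → Q v → ¬ P v → Module (P ∖ Q)
  ∖-module {P = P} {Q = Q} {v = q} mP mQ Qq ¬Pq u ∉P∖Q with lem {P = P u}
  ... | no ¬Pu = module-⊆ mP (λ _ → proj₁) ¬Pu
  ... | yes Pu = uniform-of-⇔ (Adj q u) λ p (Pp , ¬Qp) → begin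
    Adj u p  ≈⟨ Adj-⇔ ⟩
    Adj p u  ≈⟨ uniform-⇔ (mQ p ¬Qp) Qu Qq ⟩
    Adj p q  ≈⟨ Adj-⇔ ⟩
    Adj q p  ≈⟨ uniform-⇔ (mP q ¬Pq) Pp Pu ⟩
    Adj q u  ∎
    where
    open SetoidReasoning (⇔-setoid 0ℓ)
    Qu : Q u
    Qu = dne λ ¬Qu → ∉P∖Q (Pu , ¬Qu)

  singleton-module : Module ｛ a ｝
  singleton-module {a = a} u _ = uniform-of-⇔ (Adj u a) λ { _ refl → ⇔-refl }

  Resized : Pred V ℓ → Pred V 0ℓ
  Resized P z = Resize (P z)

  resized-module : Module P → Module (Resized P)
  resized-module mP u ∉ = uniform-⊆ (λ _ → unresize) (mP u (∉ ∘ resize))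

  ⟨_⟩ : Pred V ℓ → Pred V (lsuc 0ℓ ⊔ ℓ)
  ⟨ P ⟩ z = ∀ (B : Pred V 0ℓ) → Module B → P ⊆ B → B z

  ⊆-closure : P ⊆ ⟨ P ⟩
  ⊆-closure z Pz _ _ P⊆B = P⊆B z Pz

  closure-least : Module Q → P ⊆ Q → ⟨ P ⟩ ⊆ Q
  closure-least {Q = Q} mQ P⊆Q z ⟨P⟩z =
    unresize (⟨P⟩z (Resized Q) (resized-module mQ) (λ w Pw → resize (P⊆Q w Pw)))

  closure-mono : P ⊆ Q → ⟨ P ⟩ ⊆ ⟨ Q ⟩
  closure-mono P⊆Q z ⟨P⟩z B mB Q⊆B = ⟨P⟩z B mB (λ w Pw → Q⊆B w (P⊆Q w Pw))

  ∉-closure : ¬ ⟨ P ⟩ u → ∃ λ (B : Pred V 0ℓ) → Module B × P ⊆ B × ¬ B u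
  ∉-closure ∉ =
    let B , ¬[B→u] = ¬∀⇒∃¬ ∉
        mB , ¬[P⊆B→u] = ¬→⇒×¬ ¬[B→u]
    in B , mB , ¬→⇒×¬ ¬[P⊆B→u]

  closure-module : Module ⟨ P ⟩
  closure-module u ∉ with B , mB , P⊆B , ¬Bu ← ∉-closure ∉ = module-⊆ mB (closure-least mB P⊆B) ¬Bu

  -- IsStrongModule asks of a nonempty set only that it be NonOverlapping, not that it be a module,
  -- so S₂ x y need not be a module; this is why chains are studied through module closures ⟨_⟩.
  NonOverlapping : Pred V ℓ → Set (lsuc 0ℓ ⊔ ℓ)
  NonOverlapping P = ∀ (B : Pred V 0ℓ) → Module B → P ≬ B → P ⊆ B ⊎ B ⊆ P

  resized-nonOverlapping : NonOverlapping P → NonOverlapping (Resized P)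
  resized-nonOverlapping noP B mB (z , Pz , Bz) =
    Sum.map (λ P⊆B w → P⊆B w ∘ unresize) (λ B⊆P w → resize ∘ B⊆P w) (noP B mB (z , unresize Pz , Bz))

  nonOverlapping⇒strong : {P : Pred V 0ℓ} → Satisfiable P → NonOverlapping P → IsStrongModule G P
  nonOverlapping⇒strong {P = P} ∃P noP = ∃P , disjoint-or-comparable
    where
    disjoint-or-comparable : ∀ B → Module B → Disjoint P B ⊎ (P ⊆ B ⊎ B ⊆ P)
    disjoint-or-comparable B mB with lem {P = P ≬ B}
    ... | yes P≬B = inj₂ (noP B mB P≬B)
    ... | no ¬P≬B = inj₁ λ z Pz Bz → ¬P≬B (z , Pz , Bz)

  singleton-strong : IsStrongModule G ｛ a ｝
  singleton-strong = nonOverlapping⇒strong (_ , refl) λ { B mB (_ , refl , Ba) → inj₁ λ { _ refl → Ba } }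

  S₂-left : S₂ G x y x
  S₂-left _ _ Ax _ = Ax

  S₂-right : S₂ G x y y
  S₂-right _ _ _ Ay = Ay

  S₂-swap : S₂ G x y ⊆ S₂ G y x
  S₂-swap _ Sz A sA Ay Ax = Sz A sA Ax Ay

  S₂-least : {A : Pred V 0ℓ} → IsStrongModule G A → A x → A y → S₂ G x y ⊆ A
  S₂-least sA Ax Ay _ Sz = Sz _ sA Ax Ay

  S₂-nonOverlapping : NonOverlapping (S₂ G x y)
  S₂-nonOverlapping {x = x} {y = y} B mB (z , Sz , Bz)
    with lem {P = ∃ λ (A : Pred V 0ℓ) → IsStrongModule G A × A x × A y × A ⊆ B}
  ... | yes (A , sA , Ax , Ay , A⊆B) = inj₁ λ w Sw → A⊆B w (S₂-least sA Ax Ay w Sw)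
  ... | no ∄A = inj₂ λ w Bw A sA Ax Ay → B⊆A A sA Ax Ay w Bw
    where
    B⊆A : ∀ A → IsStrongModule G A → A x → A y → B ⊆ A
    B⊆A A sA@(_ , comparable) Ax Ay with comparable B mB
    ... | inj₁ disjoint = ⊥-elim (disjoint z (S₂-least sA Ax Ay z Sz) Bz)
    ... | inj₂ (inj₁ A⊆B) = ⊥-elim (∄A (A , sA , Ax , Ay , A⊆B))
    ... | inj₂ (inj₂ B⊆A) = B⊆A

  S₂-strong : IsStrongModule G (Resized (S₂ G x y))
  S₂-strong = nonOverlapping⇒strong (_ , resize S₂-left) (resized-nonOverlapping S₂-nonOverlapping)

  MaxModule : V → V → Pred V 0ℓ
  MaxModule a b z = Resize (∃ λ (B : Pred V 0ℓ) → Module B × B a × ¬ B b × B z)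

  MaxModule-max : {B : Pred V 0ℓ} → Module B → B a → ¬ B b → B ⊆ MaxModule a b
  MaxModule-max mB Ba ¬Bb z Bz = resize (_ , mB , Ba , ¬Bb , Bz)

  MaxModule-witness : MaxModule a b z → ∃ λ (B : Pred V 0ℓ) → Module B × B a × ¬ B b × B z
  MaxModule-witness = unresize

  MaxModule-∌ : ¬ MaxModule a b b
  MaxModule-∌ Mb with _ , _ , _ , ¬Bb , Bb ← MaxModule-witness Mb = ¬Bb Bb

  MaxModule-∋ : a ≢ b → MaxModule a b a
  MaxModule-∋ a≢b = MaxModule-max singleton-module refl a≢b _ refl

  MaxModule-module : Module (MaxModule a b)
  MaxModule-module {a = a} u ∉ = uniform-of-⇔ (Adj u a) λ z Mz →
    let B , mB , Ba , ¬Bb , Bz = MaxModule-witness Mz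
    in uniform-⇔ (mB u (∉ ∘ MaxModule-max mB Ba ¬Bb u)) Bz Ba

  MaxModule-absorbs : a ≢ b → {B : Pred V 0ℓ} → Module B → ¬ B b → B ≬ MaxModule a b → B ⊆ MaxModule a b
  MaxModule-absorbs a≢b mB ¬Bb (z , Bz , Mz) w Bw =
    MaxModule-max (∪-module mB MaxModule-module Bz Mz) (inj₂ (MaxModule-∋ a≢b)) [ ¬Bb , MaxModule-∌ ]′
                  w (inj₁ Bw)

  Separating : V → V → Pred V 0ℓ
  Separating a b = MaxModule a b ∪ MaxModule b a

  ⊆-Separating : a ≢ b → {B : Pred V 0ℓ} → Module B → B b → MaxModule a b ≬ ∁ B → B ⊆ Separating a b
  ⊆-Separating {a = a} {b = b} a≢b mB Bb (p , Mp , ¬Bp) w Bw with lem {P = MaxModule a b w}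
  ... | yes Mw = inj₁ Mw
  ... | no ¬Mw = inj₂ (MaxModule-max (∖-module mB MaxModule-module Mp ¬Bp) (Bb , MaxModule-∌)
                                     (λ (_ , ¬Ma) → ¬Ma (MaxModule-∋ a≢b)) w (Bw , ¬Mw))

  Separating-nonOverlapping : a ≢ b → NonOverlapping (Separating a b)
  Separating-nonOverlapping {a = a} {b = b} a≢b B mB (z , Sz , Bz) with lem {P = B a} | lem {P = B b}
  ... | yes Ba | no ¬Bb = inj₂ λ w → inj₁ ∘ MaxModule-absorbs a≢b mB ¬Bb (a , Ba , MaxModule-∋ a≢b) w
  ... | no ¬Ba | yes Bb = inj₂ λ w → inj₂ ∘ MaxModule-absorbs b≢a mB ¬Ba (b , Bb , MaxModule-∋ b≢a) w
    where b≢a = a≢b ∘ sym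
  ... | no ¬Ba | no ¬Bb =
    inj₂ ([ (λ Mz w → inj₁ ∘ MaxModule-absorbs a≢b mB ¬Bb (z , Bz , Mz) w)
          , (λ Mz w → inj₂ ∘ MaxModule-absorbs (a≢b ∘ sym) mB ¬Ba (z , Bz , Mz) w) ]′ Sz)
  ... | yes Ba | yes Bb with lem {P = Separating a b ⊆ B}
  ...   | yes S⊆B = inj₁ S⊆B
  ...   | no S⊈B with p , Sp , ¬Bp ← ¬⊆⇒∖ S⊈B =
    inj₂ ([ (λ Mp → ⊆-Separating a≢b mB Bb (p , Mp , ¬Bp))
          , (λ Mp w → Sum.swap ∘ ⊆-Separating (a≢b ∘ sym) mB Ba (p , Mp , ¬Bp) w) ]′ Sp)

  Separating-strong : a ≢ b → IsStrongModule G (Separating a b)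
  Separating-strong a≢b = nonOverlapping⇒strong (_ , inj₁ (MaxModule-∋ a≢b)) (Separating-nonOverlapping a≢b)

  S₂-⊆-Separating : a ≢ b → S₂ G a b ⊆ Separating a b
  S₂-⊆-Separating a≢b =
    S₂-least (Separating-strong a≢b) (inj₁ (MaxModule-∋ a≢b)) (inj₂ (MaxModule-∋ (a≢b ∘ sym)))

  nonOverlapping-⊆-Separating : a ≢ b → NonOverlapping P → P ⊆ Separating a b →
                                P ⊆ MaxModule a b ⊎ P a ⊎ P ⊆ MaxModule b a
  nonOverlapping-⊆-Separating {a = a} {b = b} {P = P} a≢b noP P⊆S with lem {P = P ≬ MaxModule a b}
  ... | yes P≬M = Sum.map₂ (λ M⊆P → inj₁ (M⊆P a (MaxModule-∋ a≢b))) (noP _ MaxModule-module P≬M)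
  ... | no ¬P≬M = inj₂ (inj₂ λ w Pw → [ (λ Mw → ⊥-elim (¬P≬M (w , Pw , Mw))) , id ]′ (P⊆S w Pw))

  -- For a ≢ b, S₂ x y ⊆ S₂ a b ⊆ Separating a b. If S₂ x y missed a, it would lie in MaxModule a b
  -- or MaxModule b a, and so would its closure, which contains both a and b.
  S₂-sandwich-∋ : S₂ G x y ⊆ S₂ G a b → S₂ G a b ⊆ ⟨ S₂ G x y ⟩ → S₂ G x y a
  S₂-sandwich-∋ {x = x} {y = y} {a = a} {b = b} S⊆ ⊆⟨S⟩ with lem {P = a ≡ b}
  ... | yes refl = subst (S₂ G x y) (sym a≡x) S₂-left
    where
    a≡x : a ≡ x
    a≡x = S₂-least singleton-strong refl refl x (S⊆ x S₂-left)
  ... | no a≢b with nonOverlapping-⊆-Separating a≢b S₂-nonOverlapping (λ w → S₂-⊆-Separating a≢b w ∘ S⊆ w)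
  ...   | inj₁ S⊆Mab = ⊥-elim (MaxModule-∌ (closure-least MaxModule-module S⊆Mab b (⊆⟨S⟩ b S₂-right)))
  ...   | inj₂ (inj₁ Sa) = Sa
  ...   | inj₂ (inj₂ S⊆Mba) = ⊥-elim (MaxModule-∌ (closure-least MaxModule-module S⊆Mba a (⊆⟨S⟩ a S₂-left)))

  S₂-sandwich : S₂ G x y ⊆ S₂ G a b → S₂ G a b ⊆ ⟨ S₂ G x y ⟩ → S₂ G a b ⊆ S₂ G x y
  S₂-sandwich {x = x} {y = y} {a = a} {b = b} S⊆ ⊆⟨S⟩ z Sz =
    unresize (Sz _ S₂-strong (resize Sa) (resize Sb))
    where
    Sa : S₂ G x y a
    Sa = S₂-sandwich-∋ S⊆ ⊆⟨S⟩
    Sb : S₂ G x y b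
    Sb = S₂-sandwich-∋ (λ w → S₂-swap w ∘ S⊆ w) (λ w → ⊆⟨S⟩ w ∘ S₂-swap w)

  _⊊_ : Pred V ℓ → Pred V ℓ₁ → Set (ℓ ⊔ ℓ₁)
  P ⊊ Q = P ⊆ Q × Satisfiable (Q ∖ P)

  remove-layer-module : Module R → P ⊆ N → N ⊆ R →
                        (∀ v → (N ∖ P) v → Complete v P) → (∀ v → (R ∖ N) v → Complete v N) →
                        Module ((R ∖ N) ∪ P)
  remove-layer-module {R = R} {P = P} {N = N} mR P⊆N N⊆R middle top u ∉ with lem {P = R u}
  ... | no ¬Ru = module-⊆ mR (λ z → [ proj₁ , N⊆R z ∘ P⊆N z ]′) ¬Ru
  ... | yes Ru = inj₁ λ z → [ (λ R∖Nz → Adj-sym (top z R∖Nz u Nu)) , middle u (Nu , ∉ ∘ inj₂) z ]′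
    where
    Nu : N u
    Nu = dne λ ¬Nu → ∉ (inj₁ (Ru , ¬Nu))

  -- Otherwise every vertex of R ∖ P is complete to P, which makes (R ∖ ⟨ Q ⟩) ∪ P a module meeting Q;
  -- but containing Q would force ⟨ Q ⟩ ⊆ P, and lying inside Q would force R ⊆ ⟨ Q ⟩.
  gap-witness : ∀ {p q r} {P : Pred V p} {Q : Pred V q} {R : Pred V r} →
                Module P → Module R → NonOverlapping Q → Q ≬ P → P ⊊ ⟨ Q ⟩ → ⟨ Q ⟩ ⊊ R →
                ∃ λ v → (R ∖ P) v × Anticomplete v P
  gap-witness {p} {q} {r} {P} {Q} {R} mP mR noQ (z , Qz , Pz) (P⊆⟨Q⟩ , w₁ , ⟨Q⟩w₁ , ¬Pw₁)
              (⟨Q⟩⊆R , w₂ , Rw₂ , ¬⟨Q⟩w₂) = dne absurd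
    where
    absurd : ¬ ¬ ∃ λ v → (R ∖ P) v × Anticomplete v P
    absurd none = [ Q⊈M′ , M′⊈Q ]′ (noQ (Resized M′) (resized-module M′-module) (z , Qz , resize (inj₂ Pz)))
      where
      complete : ∀ {n} {N : Pred V n} → Module N → P ⊆ N → ∀ v → (R ∖ N) v → Complete v N
      complete mN P⊆N v (Rv , ¬Nv) =
        [ id , (λ anti → ⊥-elim (none (v , (Rv , ¬Nv ∘ P⊆N v) , λ z → anti z ∘ P⊆N z))) ]′ (mN v ¬Nv)
      M′ : Pred V (p ⊔ lsuc 0ℓ ⊔ q ⊔ r)
      M′ = (R ∖ ⟨ Q ⟩) ∪ P
      M′-module : Module M′
      M′-module = remove-layer-module mR P⊆⟨Q⟩ ⟨Q⟩⊆R
        (λ v (⟨Q⟩v , ¬Pv) → complete mP (λ _ → id) v (⟨Q⟩⊆R v ⟨Q⟩v , ¬Pv)) (complete closure-module P⊆⟨Q⟩)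
      Q⊈M′ : ¬ Q ⊆ Resized M′
      Q⊈M′ Q⊆M′ = ¬Pw₁ (closure-least mP Q⊆P w₁ ⟨Q⟩w₁)
        where
        Q⊆P : Q ⊆ P
        Q⊆P w Qw =
          [ (λ (_ , ¬⟨Q⟩w) → ⊥-elim (¬⟨Q⟩w (⊆-closure w Qw))) , id ]′ (unresize {A = M′ w} (Q⊆M′ w Qw))
      M′⊈Q : ¬ Resized M′ ⊆ Q
      M′⊈Q M′⊆Q = ¬⟨Q⟩w₂ (⊆-closure w₂ (M′⊆Q w₂ (resize (inj₁ (Rw₂ , ¬⟨Q⟩w₂)))))

  module ChainOfModules
    {ℓ} {I : Set} (M : I → Pred V ℓ)
    (M-module : ∀ i → Module (M i))
    (M-inhabited : ∀ i → Satisfiable (M i))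
    (M-comparable : ∀ i j → M i ⊆ M j ⊎ M j ⊆ M i)
    (M-gap : ∀ p q r → M p ⊊ M q → M q ⊊ M r → ∃ λ v → (M r ∖ M p) v × Anticomplete v (M p))
    where
    private variable
      d e : Level
      D : Pred I d
      E : Pred I e
      i j k : I
      n : ℕ

    FinitelyMany : Pred I d → Set (d ⊔ ℓ)
    FinitelyMany D = ∃ λ n → ∃ λ (g : Fin n → I) → ∀ i → D i → ∃ λ k → M (g k) ≐ M i

    finitelyMany-⊆ : D ⊆ E → FinitelyMany E → FinitelyMany D
    finitelyMany-⊆ D⊆E (n , g , cover) = n , g , λ i → cover i ∘ D⊆E i

    finitelyMany-split : (E : Pred I e) → FinitelyMany (D ∩ E) → FinitelyMany (D ∖ E) → FinitelyMany D
    finitelyMany-split {D = D} E (m , g , cover∩) (n , h , cover∖) = m + n , g ++ h , cover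
      where
      cover : ∀ i → D i → ∃ λ k → M ((g ++ h) k) ≐ M i
      cover i Di with lem {P = E i}
      ... | yes Ei = let k , eq = cover∩ i (Di , Ei) in
        k ↑ˡ n , subst (λ j → M j ≐ M i) (sym (lookup-++ˡ g h k)) eq
      ... | no ¬Ei = let k , eq = cover∖ i (Di , ¬Ei) in
        m ↑ʳ k , subst (λ j → M j ≐ M i) (sym (lookup-++ʳ g h k)) eq

    infinite-split : ¬ FinitelyMany D → (E : Pred I e) → ¬ FinitelyMany (D ∩ E) ⊎ ¬ FinitelyMany (D ∖ E)
    infinite-split {D = D} inf E with lem {P = FinitelyMany (D ∩ E)}
    ... | no ¬fin∩ = inj₁ ¬fin∩
    ... | yes fin∩ = inj₂ (inf ∘ finitelyMany-split E fin∩)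

    infinite-fresh : ¬ FinitelyMany D → (g : Fin n → I) → ∃ λ i → D i × ∀ k → ¬ M (g k) ≐ M i
    infinite-fresh inf g = dne λ ∄ → inf (_ , g , λ i Di → dne λ ¬∃k → ∄ (i , Di , λ k eq → ¬∃k (k , eq)))

    ⊊-or-⊋ : ¬ M i ≐ M j → M i ⊊ M j ⊎ M j ⊊ M i
    ⊊-or-⊋ {i = i} {j = j} Mi≢Mj with M-comparable i j
    ... | inj₁ Mi⊆Mj = inj₁ (Mi⊆Mj , ¬⊆⇒∖ λ Mj⊆Mi → Mi≢Mj (Mi⊆Mj , Mj⊆Mi))
    ... | inj₂ Mj⊆Mi = inj₂ (Mj⊆Mi , ¬⊆⇒∖ λ Mi⊆Mj → Mi≢Mj (Mi⊆Mj , Mj⊆Mi))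

    record Nested (D : Pred I d) : Set (d ⊔ ℓ) where
      field
        p q r : I
        p∈D : D p
        r∈D : D r
        p⊊q : M p ⊊ M q
        q⊊r : M q ⊊ M r

    nested-of-three : D i → D j → D k → M i ⊊ M j → ¬ M i ≐ M k → ¬ M j ≐ M k → Nested D
    nested-of-three {i = i} {j = j} {k = k} Di Dj Dk i⊊j Mi≢Mk Mj≢Mk with ⊊-or-⊋ Mj≢Mk
    ... | inj₁ j⊊k = record { p = i ; q = j ; r = k ; p∈D = Di ; r∈D = Dk ; p⊊q = i⊊j ; q⊊r = j⊊k }
    ... | inj₂ k⊊j with ⊊-or-⊋ Mi≢Mk
    ...   | inj₁ i⊊k = record { p = i ; q = k ; r = j ; p∈D = Di ; r∈D = Dj ; p⊊q = i⊊k ; q⊊r = k⊊j }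
    ...   | inj₂ k⊊i = record { p = k ; q = i ; r = j ; p∈D = Dk ; r∈D = Dj ; p⊊q = k⊊i ; q⊊r = i⊊j }

    infinite-nested : ¬ FinitelyMany D → Nested D
    infinite-nested inf =
      let i , Di , _ = infinite-fresh inf Vector.[]
          j , Dj , Mi≢Mj = infinite-fresh inf (i Vector.∷ Vector.[])
          k , Dk , ≢Mk = infinite-fresh inf (i Vector.∷ j Vector.∷ Vector.[])
      in [ (λ i⊊j → nested-of-three Di Dj Dk i⊊j (≢Mk Fin.zero) (≢Mk (Fin.suc Fin.zero)))
         , (λ j⊊i → nested-of-three Dj Di Dk j⊊i (≢Mk (Fin.suc Fin.zero)) (≢Mk Fin.zero))
         ]′ (⊊-or-⊋ (Mi≢Mj Fin.zero))

    Isolated : Pred V ℓ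
    Isolated v = ∀ j → ¬ M j v → Anticomplete v (M j)

    anticomplete⇒isolated : Anticomplete v (M i) → Isolated v
    anticomplete⇒isolated {i = i} anti j ¬Mjv with M-comparable j i
    ... | inj₁ Mj⊆Mi = λ z → anti z ∘ Mj⊆Mi z
    ... | inj₂ Mi⊆Mj with x , Mix ← M-inhabited i =
      [ (λ complete → ⊥-elim (anti x Mix (complete x (Mi⊆Mj x Mix)))) , id ]′ (M-module j _ ¬Mjv)

    AllOrNone : Pred I d → Pred V (d ⊔ ℓ)
    AllOrNone D w = (∀ i → D i → M i w) ⊎ (∀ i → D i → ¬ M i w)

    allOrNone-⊆ : D ⊆ E → AllOrNone E w → AllOrNone D w
    allOrNone-⊆ D⊆E = Sum.map (λ all i → all i ∘ D⊆E i) (λ none i → none i ∘ D⊆E i)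

    infinite-allOrNone : ¬ FinitelyMany U → (L : List V) →
                         ∃ λ (D : Pred I ℓ) → ¬ FinitelyMany D × All (AllOrNone D) L
    infinite-allOrNone inf [] = (λ _ → Lift ℓ ⊤) , inf ∘ finitelyMany-⊆ (λ _ _ → lift tt) , []
    infinite-allOrNone inf (w ∷ L) with D , infD , sides ← infinite-allOrNone inf L
                                   with infinite-split infD (λ i → M i w)
    ... | inj₁ inf∩ = D ∩ (λ i → M i w) , inf∩ , inj₁ (λ _ → proj₂) ∷ All.map (allOrNone-⊆ (λ _ → proj₁)) sides
    ... | inj₂ inf∖ = D ∖ (λ i → M i w) , inf∖ , inj₂ (λ _ → proj₂) ∷ All.map (allOrNone-⊆ (λ _ → proj₁)) sides

    gap-vertex-apart : D i → D k → (M k ∖ M i) v → Anticomplete v (M i) →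
                       Isolated w → AllOrNone D w → Apart G v w
    gap-vertex-apart {i = i} {w = w} Di _ (_ , ¬Miv) anti _ (inj₁ all) =
      (λ { refl → ¬Miv (all i Di) }) , anti w (all i Di)
    gap-vertex-apart {k = k} {v = v} _ Dk (Mkv , _) _ isolated (inj₂ none) =
      (λ { refl → none k Dk Mkv }) , λ v~w → isolated k (none k Dk) v Mkv (Adj-sym v~w)

    nested-extension : Nested D → {L : List V} → All (AllOrNone D) L → All Isolated L →
                       ∃ λ v → Isolated v × All (Apart G v) L
    nested-extension N sides isolatedL =
      let v , Mr∖Mp , anti = M-gap p q r p⊊q q⊊r
      in v , anticomplete⇒isolated anti
           , All.zipWith (λ (side , iso) → gap-vertex-apart p∈D r∈D Mr∖Mp anti iso side) (sides , isolatedL)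
      where open Nested N

    infinite-independent : ¬ FinitelyMany U → ∃ λ (A : Pred V 0ℓ) → Independent G A × ¬ Finite A
    infinite-independent inf = infinite-independent-of-extension G Isolated λ L →
      let D , infD , sides = infinite-allOrNone inf L in nested-extension (infinite-nested infD) sides

  module RobustChain {I : Set} (c : I → V × V) (chain : IsChainFamily G c) where
    private variable
      i j : I

    T H : I → Pred V (lsuc 0ℓ)
    T i = RobustOf G (c i)
    H i = ⟨ T i ⟩

    H-module : ∀ i → Module (H i)
    H-module _ = closure-module

    H-inhabited : ∀ i → Satisfiable (H i)
    H-inhabited i = _ , ⊆-closure _ S₂-left

    H-comparable : ∀ i j → H i ⊆ H j ⊎ H j ⊆ H i
    H-comparable i j = Sum.map closure-mono closure-mono (chain i j)

    H-≐⇒T-≐ : H i ≐ H j → T i ≐ T j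
    H-≐⇒T-≐ {i = i} {j = j} (Hi⊆Hj , Hj⊆Hi) with chain i j
    ... | inj₁ Ti⊆Tj = Ti⊆Tj , S₂-sandwich Ti⊆Tj (λ z → Hj⊆Hi z ∘ ⊆-closure z)
    ... | inj₂ Tj⊆Ti = S₂-sandwich Tj⊆Ti (λ z → Hi⊆Hj z ∘ ⊆-closure z) , Tj⊆Ti

    H-⊊⇒T-⊆ : H i ⊊ H j → T i ⊆ T j
    H-⊊⇒T-⊆ {i = i} {j = j} (_ , w , Hjw , ¬Hiw) =
      [ id , (λ Tj⊆Ti → ⊥-elim (¬Hiw (closure-mono Tj⊆Ti w Hjw))) ]′ (chain i j)

    H-gap : ∀ p q r → H p ⊊ H q → H q ⊊ H r → ∃ λ v → (H r ∖ H p) v × Anticomplete v (H p)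
    H-gap p q r p⊊q q⊊r = gap-witness closure-module closure-module S₂-nonOverlapping Tq≬Hp p⊊q q⊊r
      where
      Tq≬Hp : T q ≬ H p
      Tq≬Hp = _ , H-⊊⇒T-⊆ p⊊q _ S₂-left , ⊆-closure _ S₂-left

    open ChainOfModules H H-module H-inhabited H-comparable H-gap public

    H-infinite : ¬ FiniteImage G c → ¬ FinitelyMany U
    H-infinite ¬finite (n , g , cover) =
      ¬finite (n , g , λ i → let k , Hk≐Hi = cover i tt in k , H-≐⇒T-≐ Hk≐Hi)

proposition6p9 : (lem : ∀ {ℓ : Level} → ExcludedMiddle ℓ) → (G : Graph) → NoInfiniteIndependentSet G → (I : Set) → (c : I → Graph.V G × Graph.V G) → IsChainFamily G c → FiniteImage G c
proposition6p9 lem G noInfinite I c chain = dne (uncurry noInfinite ∘ infinite-independent ∘ H-infinite)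
  where
  open Classical lem
  open ModularDecomposition lem G
  open RobustChain c chain
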